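{- Let $S=\{s_n\}_{n\ge1}$ be an increasing sequence (finite or infinite) of positive odd integers with counting function $S(y)=\#\{n: s_n\le y\}$. For a positive even integer $x$, let $g(x)$ be the number of pairs $(a,b)$ with $a\le b$, $a,b\in S$, $a+b=x$ (the number of unordered representations of $x$ as a sum of two terms of $S$). Then for every even $x\ge4$, $$g(x)=\sum_{s\in S,\ s\le x/2}S(x-s)-\binom{S(x/2)}{2}-g(x-2)-g(x-4)-\dots-g(2).$$ -}

module Defs where

open import Data.Bool using (Bool; true; _∧_)
open import Data.Nat using (ℕ; suc; _∸_; _*_; _≤ᵇ_; _%_)
open import Data.List using (List; length; map; upTo; filterᵇ)
open import Data.Nat.ListAction using (sum)

-- A set S of naturals, given by its characteristic function.
-- (An increasing sequence, finite or infinite, is the same as its set of terms.)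
Seq : Set
Seq = ℕ → Bool

count : Seq → ℕ → ℕ
count S y = length (filterᵇ S (upTo (suc y)))

g : Seq → ℕ → ℕ
g S x = length (filterᵇ (λ a → S a ∧ S (x ∸ a) ∧ (a ≤ᵇ (x ∸ a))) (upTo (suc x)))

sumCount : Seq → ℕ → ℕ → ℕ
sumCount S x y = sum (map (λ s → count S (x ∸ s)) (filterᵇ S (upTo (suc y))))

sumG : Seq → ℕ → ℕ
sumG S m = sum (map (λ k → g S (2 * suc k)) (upTo (m ∸ 1)))

{-# OPTIONS --safe #-}
-- Let D(m) = Σ_{s ∈ S, s ≤ m} S(2m − s). Going from m to m + 1, a term with s ≤ m grows only by
-- [2m + 2 − s ∈ S], because 2m + 1 − s is even and hence not in S; these increments count the
-- representations (s , 2m + 2 − s) of 2m + 2 with s ≤ m. The new term s = m + 1 contributes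
-- S(m) + 1 when m + 1 ∈ S: the growth of binom(S(m), 2) plus the representation (m+1) + (m+1).
-- Hence D(m) = binom(S(m), 2) + g(2) + g(4) + … + g(2m), which is the claim.

module Submission where

open import Defs
open import Data.Bool using (Bool; true; false; _∧_)
open import Data.Bool.Properties using (∧-identityʳ; ∧-zeroʳ; T-≡)
open import Data.Nat using (ℕ; zero; suc; _≤_; _<_; _*_; _%_; _+_; _∸_; _≤ᵇ_; z≤n; s≤s)
open import Data.Nat.Properties
open import Data.Nat.DivMod using (%-distribˡ-+; %-remove-+ʳ)
open import Data.Nat.Divisibility using (m∣m*n)
open import Data.Nat.Combinatorics using (_C_; nC1≡n; nCk+nC[k+1]≡[n+1]C[k+1])
open import Data.Nat.ListAction using (sum)
open import Data.Nat.ListAction.Properties using (sum-++)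
open import Data.Nat.Solver using (module +-*-Solver)
open import Data.Integer using (+_; _-_)
open import Data.Integer.Properties using ([+m]-[+n]≡m⊖n; ⊖-≥)
open import Data.List using ([]; _∷_; [_]; _++_; _∷ʳ_; length; map; upTo; filterᵇ)
open import Data.List.Properties using (upTo-∷ʳ; map-++)
open import Data.Sum using (inj₁; inj₂)
open import Function using (_∘_; Equivalence)
open import Relation.Binary.PropositionalEquality hiding ([_])
open import Relation.Nullary using (contradiction)

open ≡-Reasoning

𝟙 : Bool → ℕ
𝟙 true  = 1
𝟙 false = 0

∑< : ℕ → (ℕ → ℕ) → ℕ
∑< zero    f = 0
∑< (suc n) f = ∑< n f + f n

infix 5 ∑<
syntax ∑< n (λ i → e) = ∑[ i < n ] e

∑-cong : ∀ n {f h : ℕ → ℕ} → (∀ i → i < n → f i ≡ h i) → ∑[ i < n ] f i ≡ ∑[ i < n ] h i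
∑-cong zero    f≗h = refl
∑-cong (suc n) f≗h = cong₂ _+_ (∑-cong n (λ i i<n → f≗h i (m<n⇒m<1+n i<n))) (f≗h n ≤-refl)

∑-+ : ∀ n (f h : ℕ → ℕ) → ∑[ i < n ] (f i + h i) ≡ (∑[ i < n ] f i) + (∑[ i < n ] h i)
∑-+ zero    f h = refl
∑-+ (suc n) f h = trans (cong (_+ (f n + h n)) (∑-+ n f h))
                        (+-*-Solver.solve 4
                           (λ a b c d → (a :+ b) :+ (c :+ d) := (a :+ c) :+ (b :+ d))
                           refl (∑< n f) (∑< n h) (f n) (h n))
  where open +-*-Solver using (_:+_; _:=_)

∑-vanishing-tail : ∀ {n} N (f : ℕ → ℕ) → n ≤ N → (∀ i → n ≤ i → f i ≡ 0) →
                   ∑[ i < N ] f i ≡ ∑[ i < n ] f i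
∑-vanishing-tail zero    f z≤n f≡0 = refl
∑-vanishing-tail {n} (suc N) f n≤1+N f≡0 with m≤n⇒m<n∨m≡n n≤1+N
... | inj₂ refl = refl
... | inj₁ n<1+N = trans (cong₂ _+_ (∑-vanishing-tail N f n≤N f≡0) (f≡0 N n≤N)) (+-identityʳ _)
  where
  n≤N : n ≤ N
  n≤N = ≤-pred n<1+N

sum-map-upTo : ∀ (f : ℕ → ℕ) n → sum (map f (upTo n)) ≡ ∑[ i < n ] f i
sum-map-upTo f zero    = refl
sum-map-upTo f (suc n) = begin
  sum (map f (upTo (suc n)))           ≡⟨ cong (sum ∘ map f) (upTo-∷ʳ n) ⟨
  sum (map f (upTo n ∷ʳ n))            ≡⟨ cong sum (map-++ f (upTo n) [ n ]) ⟩
  sum (map f (upTo n) ++ [ f n ])      ≡⟨ sum-++ (map f (upTo n)) [ f n ] ⟩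
  sum (map f (upTo n)) + (f n + 0)     ≡⟨ cong₂ _+_ (sum-map-upTo f n) (+-identityʳ (f n)) ⟩
  (∑[ i < n ] f i) + f n               ∎

length-filterᵇ : ∀ {A : Set} (P : A → Bool) xs → length (filterᵇ P xs) ≡ sum (map (𝟙 ∘ P) xs)
length-filterᵇ P []       = refl
length-filterᵇ P (x ∷ xs) with P x
... | true  = cong suc (length-filterᵇ P xs)
... | false = length-filterᵇ P xs

sum-map-filterᵇ : ∀ {A : Set} (P : A → Bool) (f : A → ℕ) xs →
                  sum (map f (filterᵇ P xs)) ≡ sum (map (λ x → 𝟙 (P x) * f x) xs)
sum-map-filterᵇ P f []       = refl
sum-map-filterᵇ P f (x ∷ xs) with P x
... | true  = cong₂ _+_ (sym (+-identityʳ (f x))) (sum-map-filterᵇ P f xs)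
... | false = sum-map-filterᵇ P f xs

𝟙*-split : ∀ b c {x y} → (b ≡ true → x ≡ y + 𝟙 c) → 𝟙 b * x ≡ 𝟙 b * y + 𝟙 (b ∧ c)
𝟙*-split false c         step = refl
𝟙*-split true  c {x} {y} step = begin
  x + 0          ≡⟨ +-identityʳ x ⟩
  x              ≡⟨ step refl ⟩
  y + 𝟙 c        ≡⟨ cong (_+ 𝟙 c) (+-identityʳ y) ⟨
  y + 0 + 𝟙 c    ∎

[n+𝟙b]C2 : ∀ n b → (n + 𝟙 b) C 2 ≡ n C 2 + 𝟙 b * n
[n+𝟙b]C2 n false = trans (cong (_C 2) (+-identityʳ n)) (sym (+-identityʳ (n C 2)))
[n+𝟙b]C2 n true  = begin
  (n + 1) C 2        ≡⟨ cong (_C 2) (+-comm n 1) ⟩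
  suc n C 2          ≡⟨ nCk+nC[k+1]≡[n+1]C[k+1] n 1 ⟨
  n C 1 + n C 2      ≡⟨ cong (_+ n C 2) (nC1≡n n) ⟩
  n + n C 2          ≡⟨ +-comm n (n C 2) ⟩
  n C 2 + n          ≡⟨ cong (_+_ (n C 2)) (+-identityʳ n) ⟨
  n C 2 + (n + 0)    ∎

≤ᵇ-true : ∀ {m n} → m ≤ n → (m ≤ᵇ n) ≡ true
≤ᵇ-true = Equivalence.to T-≡ ∘ ≤⇒≤ᵇ

≤ᵇ-false : ∀ {m n} → n < m → (m ≤ᵇ n) ≡ false
≤ᵇ-false {m} {n} n<m with m ≤ᵇ n | ≤ᵇ⇒≤ m n
... | false | _   = refl
... | true  | m≤n = contradiction (m≤n _) (<⇒≱ n<m)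

2*n≡n+n : ∀ n → 2 * n ≡ n + n
2*n≡n+n n = cong (_+_ n) (+-identityʳ n)

2*n∸n≡n : ∀ n → 2 * n ∸ n ≡ n
2*n∸n≡n n = trans (cong (_∸ n) (2*n≡n+n n)) (m+n∸m≡n n n)

≤⇒≤2*n∸ : ∀ {a n} → a ≤ n → a ≤ 2 * n ∸ a
≤⇒≤2*n∸ {a} {n} a≤n = m+n≤o⇒m≤o∸n a (subst (a + a ≤_) (sym (2*n≡n+n n)) (+-mono-≤ a≤n a≤n))

>⇒2*n∸< : ∀ {a n} → n < a → 2 * n ∸ a < a
>⇒2*n∸< {suc a} {n} n<a =
  m<n+o⇒m∸n<o (2 * n) (suc a) (subst (_< suc a + suc a) (sym (2*n≡n+n n)) (+-mono-< n<a n<a))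

2*[1+m]∸s≡2+[2*m∸s] : ∀ m {s} → s ≤ 2 * m → 2 * suc m ∸ s ≡ suc (suc (2 * m ∸ s))
2*[1+m]∸s≡2+[2*m∸s] m {s} s≤2m = trans (cong (_∸ s) (*-suc 2 m)) (+-∸-assoc 2 s≤2m)

module _ (S : Seq) where

  count≡∑ : ∀ y → count S y ≡ ∑[ i < suc y ] 𝟙 (S i)
  count≡∑ y = trans (length-filterᵇ S (upTo (suc y))) (sum-map-upTo (𝟙 ∘ S) (suc y))

  count-suc : ∀ y → count S (suc y) ≡ count S y + 𝟙 (S (suc y))
  count-suc y = trans (count≡∑ (suc y)) (cong (_+ 𝟙 (S (suc y))) (sym (count≡∑ y)))

  sumCount≡∑ : ∀ x y → sumCount S x y ≡ ∑[ s < suc y ] 𝟙 (S s) * count S (x ∸ s)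
  sumCount≡∑ x y = trans (sum-map-filterᵇ S (λ s → count S (x ∸ s)) (upTo (suc y)))
                         (sum-map-upTo (λ s → 𝟙 (S s) * count S (x ∸ s)) (suc y))

  g-even : ∀ n → g S (2 * n) ≡ ∑[ a < suc n ] 𝟙 (S a ∧ S (2 * n ∸ a))
  g-even n = begin
    g S x                           ≡⟨ length-filterᵇ pair? (upTo (suc x)) ⟩
    sum (map (𝟙 ∘ pair?) (upTo (suc x)))
                                    ≡⟨ sum-map-upTo (𝟙 ∘ pair?) (suc x) ⟩
    ∑[ a < suc x ] 𝟙 (pair? a)
      ≡⟨ ∑-vanishing-tail (suc x) (𝟙 ∘ pair?) (s≤s (m≤n*m n 2)) beyond-half ⟩
    ∑[ a < suc n ] 𝟙 (pair? a)
      ≡⟨ ∑-cong (suc n) (λ a a<1+n → cong 𝟙 (below-half (≤-pred a<1+n))) ⟩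
    ∑[ a < suc n ] 𝟙 (S a ∧ S (x ∸ a)) ∎
    where
    x : ℕ
    x = 2 * n
    pair? : ℕ → Bool
    pair? a = S a ∧ S (x ∸ a) ∧ (a ≤ᵇ x ∸ a)
    below-half : ∀ {a} → a ≤ n → pair? a ≡ S a ∧ S (x ∸ a)
    below-half {a} a≤n rewrite ≤ᵇ-true (≤⇒≤2*n∸ a≤n) =
      cong (S a ∧_) (∧-identityʳ (S (x ∸ a)))
    beyond-half : ∀ a → suc n ≤ a → 𝟙 (pair? a) ≡ 0
    beyond-half a n<a
      rewrite ≤ᵇ-false (>⇒2*n∸< n<a) | ∧-zeroʳ (S (x ∸ a)) | ∧-zeroʳ (S a) = refl

module _ (S : Seq) (odd : ∀ n → S n ≡ true → n % 2 ≡ 1) where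

  0∉S : S 0 ≡ false
  0∉S with S 0 in 0∈S
  ... | false = refl
  ... | true  = contradiction (odd 0 0∈S) λ ()

  odd-sum∉S : ∀ {a b} m → S a ≡ true → a + b ≡ suc (2 * m) → S b ≡ false
  odd-sum∉S {a} {b} m a∈S a+b≡1+2m with S b in b∈S
  ... | false = refl
  ... | true  = contradiction (trans (sym even) odd-sum) λ ()
    where
    even : (a + b) % 2 ≡ 0
    even = trans (%-distribˡ-+ a b 2) (cong₂ (λ u v → (u + v) % 2) (odd a a∈S) (odd b b∈S))
    odd-sum : (a + b) % 2 ≡ 1
    odd-sum = trans (cong (_% 2) a+b≡1+2m) (%-remove-+ʳ 1 (m∣m*n {2} m))

  count-step : ∀ m {s} → S s ≡ true → s ≤ 2 * m →
               count S (2 * suc m ∸ s) ≡ count S (2 * m ∸ s) + 𝟙 (S (2 * suc m ∸ s))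
  count-step m {s} s∈S s≤2m rewrite 2*[1+m]∸s≡2+[2*m∸s] m s≤2m = begin
    count S (suc (suc y))                          ≡⟨ count-suc S (suc y) ⟩
    count S (suc y) + 𝟙 (S (suc (suc y)))          ≡⟨ cong (_+ 𝟙 (S (suc (suc y)))) (count-suc S y) ⟩
    count S y + 𝟙 (S (suc y)) + 𝟙 (S (suc (suc y)))
      ≡⟨ cong (λ b → count S y + 𝟙 b + 𝟙 (S (suc (suc y)))) (odd-sum∉S m s∈S s+[1+y]≡1+2m) ⟩
    count S y + 0 + 𝟙 (S (suc (suc y)))
      ≡⟨ cong (_+ 𝟙 (S (suc (suc y)))) (+-identityʳ (count S y)) ⟩
    count S y + 𝟙 (S (suc (suc y)))                ∎
    where
    y : ℕ
    y = 2 * m ∸ s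
    s+[1+y]≡1+2m : s + suc y ≡ suc (2 * m)
    s+[1+y]≡1+2m = trans (+-suc s y) (cong suc (m+[n∸m]≡n s≤2m))

  sumCount-diagonal : ∀ m → sumCount S (2 * m) m ≡ count S m C 2 + (∑[ k < m ] g S (2 * suc k))
  sumCount-diagonal zero    rewrite 0∉S = refl
  sumCount-diagonal (suc m) = begin
    sumCount S x (suc m)
      ≡⟨ sumCount≡∑ S x (suc m) ⟩
    (∑[ s < suc m ] 𝟙 (S s) * count S (x ∸ s)) + 𝟙 b * count S (x ∸ suc m)
      ≡⟨ cong₂ _+_ (∑-cong (suc m) below-diagonal) on-diagonal ⟩
    (∑[ s < suc m ] (𝟙 (S s) * count S (2 * m ∸ s) + pair s)) + (𝟙 b * c + pair (suc m))
      ≡⟨ cong (_+ (𝟙 b * c + pair (suc m))) (∑-+ (suc m) (λ s → 𝟙 (S s) * count S (2 * m ∸ s)) pair) ⟩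
    ((∑[ s < suc m ] 𝟙 (S s) * count S (2 * m ∸ s)) + P) + (𝟙 b * c + pair (suc m))
      ≡⟨ cong (λ d → (d + P) + (𝟙 b * c + pair (suc m)))
              (trans (sym (sumCount≡∑ S (2 * m) m)) (sumCount-diagonal m)) ⟩
    (c C 2 + Γ + P) + (𝟙 b * c + pair (suc m))
      ≡⟨ +-*-Solver.solve 5
           (λ C Γ P bc q → (C :+ Γ :+ P) :+ (bc :+ q) := (C :+ bc) :+ (Γ :+ (P :+ q)))
           refl (c C 2) Γ P (𝟙 b * c) (pair (suc m)) ⟩
    (c C 2 + 𝟙 b * c) + (Γ + (P + pair (suc m)))
      ≡⟨ cong₂ (λ u v → u + (Γ + v))
               (trans (cong (_C 2) (count-suc S m)) ([n+𝟙b]C2 c b)) (g-even S (suc m)) ⟨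
    count S (suc m) C 2 + (Γ + g S x)
      ∎
    where
    open +-*-Solver using (_:+_; _:=_)
    x c Γ P : ℕ
    x = 2 * suc m
    c = count S m
    Γ = ∑[ k < m ] g S (2 * suc k)
    b : Bool
    b = S (suc m)
    pair : ℕ → ℕ
    pair a = 𝟙 (S a ∧ S (x ∸ a))
    P = ∑[ s < suc m ] pair s
    below-diagonal : ∀ s → s < suc m →
                     𝟙 (S s) * count S (x ∸ s) ≡ 𝟙 (S s) * count S (2 * m ∸ s) + pair s
    below-diagonal s s<1+m =
      𝟙*-split (S s) (S (x ∸ s)) (λ s∈S → count-step m s∈S (≤-trans (≤-pred s<1+m) (m≤n*m m 2)))
    on-diagonal : 𝟙 b * count S (x ∸ suc m) ≡ 𝟙 b * c + pair (suc m)
    on-diagonal = 𝟙*-split b (S (x ∸ suc m))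
      (λ _ → subst (λ z → count S z ≡ c + 𝟙 (S z)) (sym (2*n∸n≡n (suc m))) (count-suc S m))

[+[m+n]]-[+m]≡+n : ∀ m n → + (m + n) - + m ≡ + n
[+[m+n]]-[+m]≡+n m n =
  trans ([+m]-[+n]≡m⊖n (m + n) m) (trans (⊖-≥ (m≤m+n m n)) (cong +_ (m+n∸m≡n m n)))

corollary2 : (S : Seq) → (∀ n → S n ≡ true → n % 2 ≡ 1) → (m : ℕ) → 2 ≤ m →
    + g S (2 * m) ≡ + sumCount S (2 * m) m - + (count S m C 2) - + sumG S m
corollary2 S odd (suc m) _ = sym (begin
  + sumCount S x (suc m) - + binom - + sumG S (suc m)
    ≡⟨ cong (λ n → + n - + binom - + sumG S (suc m)) diagonal ⟩
  + (binom + (sumG S (suc m) + g S x)) - + binom - + sumG S (suc m)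
    ≡⟨ cong (_- + sumG S (suc m)) ([+[m+n]]-[+m]≡+n binom (sumG S (suc m) + g S x)) ⟩
  + (sumG S (suc m) + g S x) - + sumG S (suc m)
    ≡⟨ [+[m+n]]-[+m]≡+n (sumG S (suc m)) (g S x) ⟩
  + g S x ∎)
  where
  x binom : ℕ
  x = 2 * suc m
  binom = count S (suc m) C 2
  diagonal : sumCount S x (suc m) ≡ binom + (sumG S (suc m) + g S x)
  diagonal = trans (sumCount-diagonal S odd (suc m))
                   (cong (λ γ → binom + (γ + g S x)) (sym (sum-map-upTo (λ k → g S (2 * suc k)) m)))
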